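{- Let $G=(V,E)$ be an undirected graph with positive edge weights $w$ and terminal set $T\subseteq V$, and let $s\in V$ be such that for every vertex $t\neq s$ the minimum $s$-$t$ cut is unique. For any real $\phi$, let $X=ct(s,\phi)$, and let $Y$ be any extreme set. Then either $Y\setminus X$ contains no terminal, or at least one of $X\cap Y$ and $X\setminus Y$ is empty.
   Context: For $X\subseteq V$, $d(X)$ is the total weight of edges with exactly one endpoint in $X$; $\lambda(s,t)$ is the minimum of $d(S)$ over $S$ separating $s$ and $t$. The cut threshold is $ct(s,\phi)=\{t\in V\setminus\{s\}:\lambda(s,t)\ge\phi\}\cup\{s\}$. A Steiner cut is a set $X\subseteq V$ with $X\cap T\neq\emptyset$ and $T\not\subseteq X$. A Steiner cut $X$ is extreme if every Steiner cut $Y\subsetneq X$ satisfies $d(Y)>d(X)$. -}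

module Defs where

open import Data.Nat using (ℕ; zero; suc)
open import Data.Fin using (Fin; zero; suc)
open import Data.Fin.Subset using (Subset; _∈_; _∉_; _⊂_; Nonempty)
open import Data.Fin.Subset.Properties using (_∈?_)
open import Data.Product using (_×_; ∃; Σ; _,_)
open import Data.Sum using (_⊎_)
open import Relation.Nullary using (¬_; yes; no)
open import Relation.Binary.PropositionalEquality using (_≡_; _≢_)

-- A totally ordered abelian group (e.g. the real numbers with + and ≤).
-- Edge weights and thresholds take values in such a structure.
record OrderedAbGroup : Set₁ where
  infixl 6 _+_
  infix 4 _≤_
  field
    Carrier : Set
    _+_ : Carrier → Carrier → Carrier
    0# : Carrier
    -_ : Carrier → Carrier
    _≤_ : Carrier → Carrier → Set
    +-assoc : ∀ x y z → (x + y) + z ≡ x + (y + z)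
    +-comm : ∀ x y → x + y ≡ y + x
    +-identityˡ : ∀ x → 0# + x ≡ x
    -‿inverseˡ : ∀ x → (- x) + x ≡ 0#
    ≤-refl : ∀ x → x ≤ x
    ≤-trans : ∀ {x y z} → x ≤ y → y ≤ z → x ≤ z
    ≤-antisym : ∀ {x y} → x ≤ y → y ≤ x → x ≡ y
    ≤-total : ∀ x y → x ≤ y ⊎ y ≤ x
    +-monoˡ-≤ : ∀ {x y} z → x ≤ y → x + z ≤ y + z

  _<_ : Carrier → Carrier → Set
  x < y = x ≤ y × x ≢ y

module Cuts (R : OrderedAbGroup) where
  open OrderedAbGroup R

  sumFin : ∀ {n} → (Fin n → Carrier) → Carrier
  sumFin {zero} f = 0#
  sumFin {suc n} f = f zero + sumFin (λ i → f (suc i))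

  -- Weighted undirected graph on vertex set Fin n: symmetric weight function,
  -- w u v = 0 meaning "no edge", w u v > 0 the weight of the edge uv
  -- (parallel edges merged by adding weights; self-loops never cross a cut).
  record Graph (n : ℕ) : Set where
    field
      w : Fin n → Fin n → Carrier
      w-sym : ∀ u v → w u v ≡ w v u
      w-nonneg : ∀ u v → 0# ≤ w u v

  module _ {n : ℕ} (G : Graph n) where
    open Graph G

    crossing : Subset n → Fin n → Fin n → Carrier
    crossing X u v with u ∈? X | v ∈? X
    ... | yes _ | no _ = w u v
    ... | _ | _ = 0#

    d : Subset n → Carrier
    d X = sumFin (λ u → sumFin (λ v → crossing X u v))

    Separates : Subset n → Fin n → Fin n → Set
    Separates S s t = (s ∈ S × t ∉ S) ⊎ (t ∈ S × s ∉ S)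

    λ≥ : Fin n → Fin n → Carrier → Set
    λ≥ s t φ = ∀ S → Separates S s t → φ ≤ d S

    UniqueMinCut : Fin n → Fin n → Set
    UniqueMinCut s t =
      ∃ λ S → s ∈ S × t ∉ S
        × (∀ S′ → Separates S′ s t → d S ≤ d S′)
        × (∀ S′ → s ∈ S′ → t ∉ S′ → d S′ ≤ d S → S′ ≡ S)

    IsCutThreshold : Fin n → Carrier → Subset n → Set
    IsCutThreshold s φ X =
      ∀ t → (t ∈ X → t ≡ s ⊎ (t ≢ s × λ≥ s t φ))
          × (t ≡ s ⊎ (t ≢ s × λ≥ s t φ) → t ∈ X)

    SteinerCut : Subset n → Subset n → Set
    SteinerCut T X = Nonempty (X Data.Fin.Subset.∩ T) × ¬ (T Data.Fin.Subset.⊆ X)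

    Extreme : Subset n → Subset n → Set
    Extreme T X = SteinerCut T X × (∀ Y → SteinerCut T Y → Y ⊂ X → d X < d Y)

{-# OPTIONS --safe #-}
module Submission where

-- Suppose t ∈ (Y ─ X) ∩ T, x ∈ X ∩ Y and z ∈ X ─ Y, and let C ∋ s be a minimum s-t cut.
-- As t ∉ ct(s,φ), d(C) < φ, so C contains X; hence C ─ Y separates s from z (if s ∈ Y)
-- or from x (if s ∉ Y), and d(C ─ Y) ≥ φ > d(C). But Y ─ C is a Steiner cut (it contains
-- the terminal t) strictly inside Y (it misses s or x), so extremality gives
-- d(Y) < d(Y ─ C), and posimodularity d(Y ─ C) + d(C ─ Y) ≤ d(Y) + d(C) forces
-- d(C ─ Y) < d(C). Posimodularity is checked edge by edge.

open import Defs
open import Algebra.Bundles using (AbelianGroup)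
open import Algebra.Structures using (IsAbelianGroup)
import Algebra.Properties.CommutativeMonoid.Sum as CommutativeMonoidSum
import Algebra.Properties.CommutativeSemigroup as CommutativeSemigroupProperties
import Algebra.Properties.Group as GroupProperties
import Algebra.Properties.Monoid.Mult as MonoidMult
open import Data.Bool using (Bool; true; false; _∧_; not)
open import Data.Empty using (⊥; ⊥-elim)
open import Data.Fin using (Fin; zero; suc)
open import Data.Fin.Subset
  using (Subset; _∩_; _─_; Empty; Nonempty; _∈_; _∉_; inside; outside)
open import Data.Fin.Subset.Properties
  using (_∈?_; nonempty?; x∈p∩q⁺; x∈p∩q⁻; x∈p∧x∉q⇒x∈p─q; p─q⊆p; p∩q≢∅⇒p─q⊂p)
open import Data.Nat as ℕ using (ℕ; zero; suc; z≤n; s≤s)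
open import Data.Nat.Properties using (≤ᵇ⇒≤)
open import Data.Product using (_×_; _,_; proj₁; proj₂)
open import Data.Sum using (_⊎_; inj₁; inj₂)
open import Data.Vec.Base using (_∷_; here; there)
open import Relation.Nullary using (¬_; yes; no; does)
open import Relation.Binary.PropositionalEquality
  using (_≡_; _≢_; refl; sym; trans; cong; cong₂; subst; subst₂; isEquivalence; module ≡-Reasoning)

x∈p─q⇒x∉q : ∀ {n} {x : Fin n} (p q : Subset n) → x ∈ p ─ q → x ∉ q
x∈p─q⇒x∉q (inside ∷ p) (outside ∷ q) here ()
x∈p─q⇒x∉q (_ ∷ p) (_ ∷ q) (there x∈p─q) (there x∈q) = x∈p─q⇒x∉q p q x∈p─q x∈q

infix 4 _∈ᵇ_
_∈ᵇ_ : ∀ {n} → Fin n → Subset n → Bool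
x ∈ᵇ p = does (x ∈? p)

∈ᵇ-─ : ∀ {n} (x : Fin n) (p q : Subset n) → (x ∈ᵇ p ─ q) ≡ (x ∈ᵇ p) ∧ not (x ∈ᵇ q)
∈ᵇ-─ x p q with x ∈? p | x ∈? q | x ∈? p ─ q
... | yes _   | yes x∈q | yes x∈p─q = ⊥-elim (x∈p─q⇒x∉q p q x∈p─q x∈q)
... | yes _   | yes _   | no  _     = refl
... | yes _   | no  _   | yes _     = refl
... | yes x∈p | no  x∉q | no  x∉p─q = ⊥-elim (x∉p─q (x∈p∧x∉q⇒x∈p─q x∈p x∉q))
... | no  x∉p | _       | yes x∈p─q = ⊥-elim (x∉p (p─q⊆p p q x∈p─q))
... | no  _   | _       | no  _     = refl

separatesᵇ : Bool → Bool → ℕ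
separatesᵇ true  false = 1
separatesᵇ false true  = 1
separatesᵇ _     _     = 0

separatesᵇ-posimodular : ∀ a b a′ b′ →
  separatesᵇ (a ∧ not b) (a′ ∧ not b′) ℕ.+ separatesᵇ (b ∧ not a) (b′ ∧ not a′)
    ℕ.≤ separatesᵇ a a′ ℕ.+ separatesᵇ b b′
separatesᵇ-posimodular true  true  true  true  = ≤ᵇ⇒≤ _ _ _
separatesᵇ-posimodular true  true  true  false = ≤ᵇ⇒≤ _ _ _
separatesᵇ-posimodular true  true  false true  = ≤ᵇ⇒≤ _ _ _
separatesᵇ-posimodular true  true  false false = ≤ᵇ⇒≤ _ _ _
separatesᵇ-posimodular true  false true  true  = ≤ᵇ⇒≤ _ _ _
separatesᵇ-posimodular true  false true  false = ≤ᵇ⇒≤ _ _ _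
separatesᵇ-posimodular true  false false true  = ≤ᵇ⇒≤ _ _ _
separatesᵇ-posimodular true  false false false = ≤ᵇ⇒≤ _ _ _
separatesᵇ-posimodular false true  true  true  = ≤ᵇ⇒≤ _ _ _
separatesᵇ-posimodular false true  true  false = ≤ᵇ⇒≤ _ _ _
separatesᵇ-posimodular false true  false true  = ≤ᵇ⇒≤ _ _ _
separatesᵇ-posimodular false true  false false = ≤ᵇ⇒≤ _ _ _
separatesᵇ-posimodular false false true  true  = ≤ᵇ⇒≤ _ _ _
separatesᵇ-posimodular false false true  false = ≤ᵇ⇒≤ _ _ _
separatesᵇ-posimodular false false false true  = ≤ᵇ⇒≤ _ _ _
separatesᵇ-posimodular false false false false = ≤ᵇ⇒≤ _ _ _

module OrderedAbGroupProperties (R : OrderedAbGroup) where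
  open OrderedAbGroup R

  +-isAbelianGroup : IsAbelianGroup _≡_ _+_ 0# -_
  +-isAbelianGroup = record
    { isGroup = record
      { isMonoid = record
        { isSemigroup = record
          { isMagma = record { isEquivalence = isEquivalence ; ∙-cong = cong₂ _+_ }
          ; assoc = +-assoc }
        ; identity = +-identityˡ , +-identityʳ }
      ; inverse = -‿inverseˡ , λ x → trans (+-comm x (- x)) (-‿inverseˡ x)
      ; ⁻¹-cong = cong -_ }
    ; comm = +-comm }
    where
    +-identityʳ : ∀ x → x + 0# ≡ x
    +-identityʳ x = trans (+-comm x 0#) (+-identityˡ x)

  +-abelianGroup : AbelianGroup _ _
  +-abelianGroup = record { isAbelianGroup = +-isAbelianGroup }

  open AbelianGroup +-abelianGroup using (group; commutativeSemigroup; commutativeMonoid; monoid)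
  open GroupProperties group using (//-rightDividesʳ)
  open CommutativeSemigroupProperties commutativeSemigroup public using (interchange)
  open MonoidMult monoid public using () renaming (_×_ to _·_; ×-homo-+ to ·-homo-+)
  open CommutativeMonoidSum commutativeMonoid public using (sum; sum-cong-≗; ∑-distrib-+; ∑-comm)

  +-monoʳ-≤ : ∀ {x y} z → x ≤ y → z + x ≤ z + y
  +-monoʳ-≤ {x} {y} z x≤y = subst₂ _≤_ (+-comm x z) (+-comm y z) (+-monoˡ-≤ z x≤y)

  +-mono-≤ : ∀ {x y u v} → x ≤ y → u ≤ v → x + u ≤ y + v
  +-mono-≤ {y = y} {u} x≤y u≤v = ≤-trans (+-monoˡ-≤ u x≤y) (+-monoʳ-≤ y u≤v)

  +-cancelʳ-≤ : ∀ {x y} z → x + z ≤ y + z → x ≤ y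
  +-cancelʳ-≤ {x} {y} z p =
    subst₂ _≤_ (//-rightDividesʳ z x) (//-rightDividesʳ z y) (+-monoˡ-≤ (- z) p)

  ≰⇒> : ∀ {x y} → ¬ x ≤ y → y < x
  ≰⇒> {x} {y} x≰y with ≤-total x y
  ... | inj₁ x≤y = ⊥-elim (x≰y x≤y)
  ... | inj₂ y≤x = y≤x , λ { refl → x≰y (≤-refl x) }

  ≤⇒≯ : ∀ {x y} → x ≤ y → ¬ y < x
  ≤⇒≯ x≤y (y≤x , y≢x) = y≢x (≤-antisym y≤x x≤y)

  x+x≤y+y⇒x≤y : ∀ {x y} → x + x ≤ y + y → x ≤ y
  x+x≤y+y⇒x≤y {x} {y} p with ≤-total x y
  ... | inj₁ x≤y = x≤y
  ... | inj₂ y≤x = +-cancelʳ-≤ y (≤-trans (+-monoʳ-≤ x y≤x) p)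

  ·-nonneg : ∀ n {x} → 0# ≤ x → 0# ≤ n · x
  ·-nonneg zero    0≤x = ≤-refl 0#
  ·-nonneg (suc n) {x} 0≤x = subst (_≤ x + n · x) (+-identityˡ 0#) (+-mono-≤ 0≤x (·-nonneg n 0≤x))

  ·-monoˡ-≤ : ∀ {m n} x → 0# ≤ x → m ℕ.≤ n → m · x ≤ n · x
  ·-monoˡ-≤ {n = n} x 0≤x z≤n       = ·-nonneg n 0≤x
  ·-monoˡ-≤         x 0≤x (s≤s m≤n) = +-monoʳ-≤ x (·-monoˡ-≤ x 0≤x m≤n)

  sum-mono-≤ : ∀ {n} {f g : Fin n → Carrier} → (∀ i → f i ≤ g i) → sum f ≤ sum g
  sum-mono-≤ {zero}  f≤g = ≤-refl 0#
  sum-mono-≤ {suc n} f≤g = +-mono-≤ (f≤g zero) (sum-mono-≤ (λ i → f≤g (suc i)))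

  ∑∑-distrib-+ : ∀ {n} (f g : Fin n → Fin n → Carrier) →
    sum (λ u → sum (λ v → f u v + g u v)) ≡ sum (λ u → sum (f u)) + sum (λ u → sum (g u))
  ∑∑-distrib-+ f g = begin
    sum (λ u → sum (λ v → f u v + g u v))         ≡⟨ sum-cong-≗ (λ u → ∑-distrib-+ (f u) (g u)) ⟩
    sum (λ u → sum (f u) + sum (g u))             ≡⟨ ∑-distrib-+ (λ u → sum (f u)) (λ u → sum (g u)) ⟩
    sum (λ u → sum (f u)) + sum (λ u → sum (g u)) ∎
    where open ≡-Reasoning

module CutFunctionProperties (R : OrderedAbGroup) {n : ℕ} (G : Cuts.Graph R n) where
  open OrderedAbGroup R
  open OrderedAbGroupProperties R
  open Cuts R
  open Graph G

  sumFin≡sum : ∀ {m} (f : Fin m → Carrier) → sumFin f ≡ sum f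
  sumFin≡sum {zero}  f = refl
  sumFin≡sum {suc m} f = cong (f zero +_) (sumFin≡sum (λ i → f (suc i)))

  -- d counts a cut edge once, as the ordered pair leaving X. That count is not posimodular
  -- pair by pair, but its symmetrisation over both orientations is.
  cutWeight : Subset n → Fin n → Fin n → Carrier
  cutWeight X u v = crossing G X u v + crossing G X v u

  cutWeight≡separatesᵇ·w : ∀ X u v → cutWeight X u v ≡ separatesᵇ (u ∈ᵇ X) (v ∈ᵇ X) · w u v
  cutWeight≡separatesᵇ·w X u v with u ∈? X | v ∈? X
  ... | yes _ | yes _ = +-identityˡ 0#
  ... | yes _ | no  _ = refl
  ... | no  _ | yes _ = trans (+-comm 0# (w v u)) (cong (_+ 0#) (w-sym v u))
  ... | no  _ | no  _ = +-identityˡ 0#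

  d+d≡∑∑cutWeight : ∀ X → d G X + d G X ≡ sum (λ u → sum (cutWeight X u))
  d+d≡∑∑cutWeight X = begin
    d G X + d G X                                         ≡⟨ cong₂ _+_ d≡∑∑ (trans d≡∑∑ (∑-comm c)) ⟩
    sum (λ u → sum (c u)) + sum (λ v → sum (λ u → c u v)) ≡⟨ ∑∑-distrib-+ c (λ u v → c v u) ⟨
    sum (λ u → sum (cutWeight X u))                       ∎
    where
    open ≡-Reasoning
    c : Fin n → Fin n → Carrier
    c = crossing G X
    d≡∑∑ : d G X ≡ sum (λ u → sum (c u))
    d≡∑∑ = trans (sumFin≡sum (λ u → sumFin (c u))) (sum-cong-≗ (λ u → sumFin≡sum (c u)))

  cutWeight-posimodular : ∀ A B u v →
    cutWeight (A ─ B) u v + cutWeight (B ─ A) u v ≤ cutWeight A u v + cutWeight B u v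
  cutWeight-posimodular A B u v =
    subst₂ _≤_ (split (A ─ B) (B ─ A)) (split A B)
      (·-monoˡ-≤ (w u v) (w-nonneg u v) separations-posimodular)
    where
    separations : Subset n → ℕ
    separations X = separatesᵇ (u ∈ᵇ X) (v ∈ᵇ X)

    split : ∀ X Y → (separations X ℕ.+ separations Y) · w u v ≡ cutWeight X u v + cutWeight Y u v
    split X Y = trans (·-homo-+ (w u v) (separations X) (separations Y))
                      (sym (cong₂ _+_ (cutWeight≡separatesᵇ·w X u v) (cutWeight≡separatesᵇ·w Y u v)))

    separations-posimodular :
      separations (A ─ B) ℕ.+ separations (B ─ A) ℕ.≤ separations A ℕ.+ separations B
    separations-posimodular
      rewrite ∈ᵇ-─ u A B | ∈ᵇ-─ v A B | ∈ᵇ-─ u B A | ∈ᵇ-─ v B A =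
      separatesᵇ-posimodular (u ∈ᵇ A) (u ∈ᵇ B) (v ∈ᵇ A) (v ∈ᵇ B)

  d-posimodular : ∀ A B → d G (A ─ B) + d G (B ─ A) ≤ d G A + d G B
  d-posimodular A B =
    x+x≤y+y⇒x≤y (subst₂ _≤_ (doubled (A ─ B) (B ─ A)) (doubled A B)
      (sum-mono-≤ (λ u → sum-mono-≤ (cutWeight-posimodular A B u))))
    where
    doubled : ∀ X Y → sum (λ u → sum (λ v → cutWeight X u v + cutWeight Y u v))
                    ≡ (d G X + d G Y) + (d G X + d G Y)
    doubled X Y = begin
      sum (λ u → sum (λ v → cutWeight X u v + cutWeight Y u v))
        ≡⟨ ∑∑-distrib-+ (cutWeight X) (cutWeight Y) ⟩
      sum (λ u → sum (cutWeight X u)) + sum (λ u → sum (cutWeight Y u))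
        ≡⟨ cong₂ _+_ (d+d≡∑∑cutWeight X) (d+d≡∑∑cutWeight Y) ⟨
      (d G X + d G X) + (d G Y + d G Y)
        ≡⟨ interchange (d G X) (d G X) (d G Y) (d G Y) ⟩
      (d G X + d G Y) + (d G X + d G Y) ∎
      where open ≡-Reasoning

  extreme⇒d[C─Y]<d[C] : ∀ {T Y C} → Extreme G T Y →
    SteinerCut G T (Y ─ C) → Nonempty (Y ∩ C) → d G (C ─ Y) < d G C
  extreme⇒d[C─Y]<d[C] {Y = Y} {C} (_ , minimal) steiner Y∩C≢∅ = ≰⇒> λ dC≤d[C─Y] →
    let dY<d[Y─C] = minimal (Y ─ C) steiner (p∩q≢∅⇒p─q⊂p Y C Y∩C≢∅)
        d[Y─C]≤dY = +-cancelʳ-≤ (d G (C ─ Y))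
          (≤-trans (d-posimodular Y C) (+-monoʳ-≤ (d G Y) dC≤d[C─Y]))
    in proj₂ dY<d[Y─C] (≤-antisym (proj₁ dY<d[Y─C]) d[Y─C]≤dY)

module CutThreshold (R : OrderedAbGroup) {n : ℕ} (G : Cuts.Graph R n)
  {s : Fin n} {φ : OrderedAbGroup.Carrier R} {X : Subset n}
  (ct : Cuts.IsCutThreshold R G s φ X) where
  open OrderedAbGroup R
  open OrderedAbGroupProperties R
  open CutFunctionProperties R G
  open Cuts R

  s∈X : s ∈ X
  s∈X = proj₂ (ct s) (inj₁ refl)

  λ≥-of-∈ : ∀ {q} → q ∈ X → q ≢ s → λ≥ G s q φ
  λ≥-of-∈ {q} q∈X q≢s with proj₁ (ct q) q∈X
  ... | inj₁ q≡s      = ⊥-elim (q≢s q≡s)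
  ... | inj₂ (_ , λ≥) = λ≥

  minCut-outside<φ : ∀ {t C} → t ∉ X → (∀ S → Separates G S s t → d G C ≤ d G S) → d G C < φ
  minCut-outside<φ {t} {C} t∉X minimal = ≰⇒> λ φ≤dC →
    t∉X (proj₂ (ct t) (inj₂ (t≢s , λ S separates → ≤-trans φ≤dC (minimal S separates))))
    where
    t≢s : t ≢ s
    t≢s refl = t∉X s∈X

  ∈-cheapCut : ∀ {C q} → d G C < φ → s ∈ C → q ∈ X → q ≢ s → q ∈ C
  ∈-cheapCut {C} {q} dC<φ s∈C q∈X q≢s with q ∈? C
  ... | yes q∈C = q∈C
  ... | no  q∉C = ⊥-elim (≤⇒≯ (λ≥-of-∈ q∈X q≢s C (inj₁ (s∈C , q∉C))) dC<φ)

  φ≤d[C─Y]×Y∩C≢∅ : ∀ {C Y x z} → d G C < φ → s ∈ C →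
    x ∈ X → x ∈ Y → z ∈ X → z ∉ Y → φ ≤ d G (C ─ Y) × Nonempty (Y ∩ C)
  φ≤d[C─Y]×Y∩C≢∅ {C} {Y} {x} {z} dC<φ s∈C x∈X x∈Y z∈X z∉Y with s ∈? Y
  ... | yes s∈Y =
    λ≥-of-∈ z∈X z≢s (C ─ Y) (inj₂ (x∈p∧x∉q⇒x∈p─q (∈-cheapCut dC<φ s∈C z∈X z≢s) z∉Y ,
                                   λ s∈C─Y → x∈p─q⇒x∉q C Y s∈C─Y s∈Y))
    , s , x∈p∩q⁺ (s∈Y , s∈C)
    where
    z≢s : z ≢ s
    z≢s refl = z∉Y s∈Y
  ... | no s∉Y =
    λ≥-of-∈ x∈X x≢s (C ─ Y) (inj₁ (x∈p∧x∉q⇒x∈p─q s∈C s∉Y ,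
                                   λ x∈C─Y → x∈p─q⇒x∉q C Y x∈C─Y x∈Y))
    , x , x∈p∩q⁺ (x∈Y , ∈-cheapCut dC<φ s∈C x∈X x≢s)
    where
    x≢s : x ≢ s
    x≢s refl = s∉Y x∈Y

  straddled-extreme-excludes-cheapCut : ∀ {T Y C t x z} → Extreme G T Y → d G C < φ → s ∈ C →
    t ∈ Y → t ∈ T → t ∉ C → x ∈ X ∩ Y → z ∈ X ─ Y → ⊥
  straddled-extreme-excludes-cheapCut {T} {Y} {C} {t}
    extreme@(steinerY , _) dC<φ s∈C t∈Y t∈T t∉C x∈X∩Y z∈X─Y =
    ≤⇒≯ (≤-trans (proj₁ dC<φ) (proj₁ separation))
        (extreme⇒d[C─Y]<d[C] extreme steinerY─C (proj₂ separation))
    where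
    separation : φ ≤ d G (C ─ Y) × Nonempty (Y ∩ C)
    separation = φ≤d[C─Y]×Y∩C≢∅ dC<φ s∈C (proj₁ (x∈p∩q⁻ X Y x∈X∩Y)) (proj₂ (x∈p∩q⁻ X Y x∈X∩Y))
                   (p─q⊆p X Y z∈X─Y) (x∈p─q⇒x∉q X Y z∈X─Y)
    steinerY─C : SteinerCut G T (Y ─ C)
    steinerY─C = (t , x∈p∩q⁺ (x∈p∧x∉q⇒x∈p─q t∈Y t∉C , t∈T))
               , λ T⊆Y─C → proj₂ steinerY (λ i∈T → p─q⊆p Y C (T⊆Y─C i∈T))

  extreme-not-straddled : ∀ {T Y t x z} → (∀ t → t ≢ s → UniqueMinCut G s t) → Extreme G T Y →
    t ∈ (Y ─ X) ∩ T → x ∈ X ∩ Y → z ∈ X ─ Y → ⊥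
  extreme-not-straddled {T} {Y} {t} minCuts extreme t∈[Y─X]∩T x∈X∩Y z∈X─Y = refute (minCuts t t≢s)
    where
    t∈Y─X : t ∈ Y ─ X
    t∈Y─X = proj₁ (x∈p∩q⁻ (Y ─ X) T t∈[Y─X]∩T)
    t∉X : t ∉ X
    t∉X = x∈p─q⇒x∉q Y X t∈Y─X
    t≢s : t ≢ s
    t≢s refl = t∉X s∈X
    refute : UniqueMinCut G s t → ⊥
    refute (C , s∈C , t∉C , minimal , _) =
      straddled-extreme-excludes-cheapCut extreme (minCut-outside<φ t∉X minimal) s∈C
        (p─q⊆p Y X t∈Y─X) (proj₂ (x∈p∩q⁻ (Y ─ X) T t∈[Y─X]∩T)) t∉C x∈X∩Y z∈X─Y

mainTheorem9 : (R : OrderedAbGroup) {n : ℕ} (G : Cuts.Graph R n) (T : Subset n) (s : Fin n) →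
    (∀ t → t ≢ s → Cuts.UniqueMinCut R G s t) →
    (φ : OrderedAbGroup.Carrier R) (X : Subset n) → Cuts.IsCutThreshold R G s φ X →
    (Y : Subset n) → Cuts.Extreme R G T Y →
    Empty ((Y ─ X) ∩ T) ⊎ Empty (X ∩ Y) ⊎ Empty (X ─ Y)
mainTheorem9 R G T s minCuts φ X ct Y extreme
  with nonempty? ((Y ─ X) ∩ T) | nonempty? (X ∩ Y) | nonempty? (X ─ Y)
... | no  ∄t       | _            | _            = inj₁ ∄t
... | yes _        | no  ∄x       | _            = inj₂ (inj₁ ∄x)
... | yes _        | yes _        | no  ∄z       = inj₂ (inj₂ ∄z)
... | yes (_ , t∈) | yes (_ , x∈) | yes (_ , z∈) =
  ⊥-elim (CutThreshold.extreme-not-straddled R G ct minCuts extreme t∈ x∈ z∈)
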